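{- Let $p=2$, and let $c\in\mathbb{N}$, $d\in\mathbb{N}^{*}$ with $\gcd(c,2)=1$, $\gcd(d,2)=1$ and $\gcd(c,d)=1$. Define sequences $(\alpha_i)_{i\ge 0}$ and $(\beta_i)_{i\ge 0}$ by $$\beta_0=c,\qquad \alpha_i=\beta_i d^{ -1}\bmod 2\ \ (i\ge 0),\qquad \beta_{i+1}=\frac{\beta_i-\alpha_i d}{2}\in\mathbb{Z}\ \ (i\ge 0).$$ Then: (1) If $c<d$, then $0\le|\beta_i|<d$ for all $i\in\mathbb{N}$. (2) Suppose $c>d$. (2.1) If $0<\frac{c}{2d}<1$, then $|\beta_i|<d$ for all $i\in\mathbb{N}^{*}$. (2.2) If $1<\frac{c}{2d}$, let $m=\left\lfloor \dfrac{\log\left(\frac{c}{2d}\right)}{\log 2}\right\rfloor$. Then $d\le|\beta_i|\le c$ for $0\le i<m+1$; $0\le|\beta_i|\le d$ for $i>m+1$; and $0\le|\beta_i|<c$ for $i=m+1$.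
   Context: For an integer $b$ and an odd integer $d$, the notation $b\,d^{ -1}\bmod 2$ denotes the unique element of $\{0,1\}$ congruent modulo $2$ to $b\cdot d'$, where $d'$ is an inverse of $d$ modulo $2$. $\lfloor x\rfloor$ denotes the integer part of $x$. -}

module Defs where

open import Data.Nat as ℕ using (ℕ; zero; suc)
open import Data.Integer as ℤ using (ℤ; +_; _-_; _*_)
open import Data.Integer.DivMod using (_/_; _%_)

-- Given c, d and a chosen inverse d' of d modulo 2 (d * d' ≡ 1 mod 2),
-- β 0 = c, α i = (β i * d') mod 2 ∈ {0,1}, β (i+1) = (β i - α i * d) / 2.
-- (β i - α i * d is even, so the floored division _div_ is exact.)
mutual
  β : ℕ → ℕ → ℤ → ℕ → ℤ
  β c d d' zero    = + c
  β c d d' (suc i) = (β c d d' i - (+ α c d d' i) * (+ d)) / (+ 2)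

  α : ℕ → ℕ → ℤ → ℕ → ℕ
  α c d d' i = (β c d d' i * d') % (+ 2)

-- Since α i d ≡ β i (mod 2), the division is exact: β i = 2 β (i+1) + α i d with α i ∈ {0, 1},
-- so 2 β (i+1) ≤ β i ≤ 2 β (i+1) + d.  These bounds map (-d, 2d) into (-d, d), and iterated
-- they give 2^i β i ≤ c and c + d ≤ 2^i (β i + d).  When 2^m 2d ≤ c < 2^(m+1) 2d the second
-- keeps β i > d for i ≤ m, whence 0 < β (m+1), while the first gives β (m+1) < 2d; from
-- there on the sequence is trapped in (-d, d).

module Submission where

open import Defs using (α; β)

module Parity where
  open import Data.Nat as ℕ using (zero; suc; s≤s)
  open import Data.Integer
  open import Data.Integer.Properties
  open import Data.Integer.DivMod using (_/_; _%_; a≡a%n+[a/n]*n; n%d<d)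
  open import Data.Integer.Divisibility.Signed using (_∣_; divides)
  open import Data.Integer.Tactic.RingSolver using (solve-∀)
  open import Relation.Nullary using (contradiction)
  open import Relation.Binary.PropositionalEquality
  open ≡-Reasoning

  1≢k*2 : ∀ k → + 1 ≢ k * + 2
  1≢k*2 (+ zero)     ()
  1≢k*2 +[1+ zero ]  ()
  1≢k*2 +[1+ suc _ ] ()
  1≢k*2 -[1+ _ ]     ()

  [k*2]/2≡k : ∀ k → (k * + 2) / + 2 ≡ k
  [k*2]/2≡k k = by-remainder _ (n%d<d (k * + 2) (+ 2)) (a≡a%n+[a/n]*n (k * + 2) (+ 2))
    where
    q = (k * + 2) / + 2
    by-remainder : ∀ r → r ℕ.< 2 → k * + 2 ≡ + r + q * + 2 → q ≡ k
    by-remainder zero          _                 eq =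
      *-cancelʳ-≡ q k (+ 2) (sym (trans eq (+-identityˡ (q * + 2))))
    by-remainder (suc zero)    _                 eq = contradiction (begin
      + 1                     ≡⟨ add-sub q ⟩
      + 1 + q * + 2 - q * + 2 ≡⟨ cong (_- q * + 2) (sym eq) ⟩
      k * + 2 - q * + 2       ≡⟨ factor k q ⟩
      (k - q) * + 2           ∎) (1≢k*2 (k - q))
      where
      add-sub : ∀ q → + 1 ≡ + 1 + q * + 2 - q * + 2
      add-sub = solve-∀
      factor : ∀ k q → k * + 2 - q * + 2 ≡ (k - q) * + 2
      factor = solve-∀
    by-remainder (suc (suc _)) (s≤s (s≤s ())) _

  2∣x⇒[x/2]*2≡x : ∀ {x} → + 2 ∣ x → (x / + 2) * + 2 ≡ x
  2∣x⇒[x/2]*2≡x (divides k refl) = cong (_* + 2) ([k*2]/2≡k k)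

  -- Writing d d' = 1 + 2q and x d' = a + 2r, the defect x - a d equals 2 (r d - x q).
  inverse-digit-defect-even : ∀ D d' → (D * d') % + 2 ≡ 1 →
    ∀ x → + 2 ∣ x - + ((x * d') % + 2) * D
  inverse-digit-defect-even D d' inv x = divides (r * D - x * q) (begin
    x - + a * D                                ≡⟨ cong (λ t → x - t * D) xd' ⟩
    x - (x * d' - r * + 2) * D                 ≡⟨ expand x d' D r ⟩
    x - x * (D * d') + r * D * + 2             ≡⟨ cong (λ t → x - x * t + r * D * + 2) Dd' ⟩
    x - x * (+ 1 + q * + 2) + r * D * + 2      ≡⟨ collect x q r D ⟩
    (r * D - x * q) * + 2                      ∎)
    where
    a = (x * d') % + 2
    r = (x * d') / + 2
    q = (D * d') / + 2
    Dd' : D * d' ≡ + 1 + q * + 2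
    Dd' = trans (a≡a%n+[a/n]*n (D * d') (+ 2)) (cong (λ t → + t + q * + 2) inv)
    xd' : + a ≡ x * d' - r * + 2
    xd' = trans (isolate (+ a) r) (cong (_- r * + 2) (sym (a≡a%n+[a/n]*n (x * d') (+ 2))))
      where
      isolate : ∀ a r → a ≡ a + r * + 2 - r * + 2
      isolate = solve-∀
    expand : ∀ x d' D r → x - (x * d' - r * + 2) * D ≡ x - x * (D * d') + r * D * + 2
    expand = solve-∀
    collect : ∀ x q r D → x - x * (+ 1 + q * + 2) + r * D * + 2 ≡ (r * D - x * q) * + 2
    collect = solve-∀

module IntegerOrder where
  open import Data.Nat as ℕ using (suc; s≤s)
  open import Data.Integer
  open import Data.Integer.Properties using (+-monoˡ-<)
  open import Data.Integer.Tactic.RingSolver using (solve-∀)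
  open import Relation.Binary.PropositionalEquality using (_≡_; subst₂)

  +-cancelʳ-< : ∀ {i j} k → i + k < j + k → i < j
  +-cancelʳ-< {i} {j} k i+k<j+k = subst₂ _<_ (cancel i k) (cancel j k) (+-monoˡ-< (- k) i+k<j+k)
    where
    cancel : ∀ i k → i + k + - k ≡ i
    cancel = solve-∀

  ∣i∣<n⇒-n<i : ∀ {i n} → ∣ i ∣ ℕ.< n → - + n < i
  ∣i∣<n⇒-n<i {+ _}      {suc _} _         = -<+
  ∣i∣<n⇒-n<i { -[1+ _ ]} {suc _} (s≤s m<n) = -<- m<n

  ∣i∣<n⇒i<n : ∀ {i n} → ∣ i ∣ ℕ.< n → i < + n
  ∣i∣<n⇒i<n {+ _}      m<n = +<+ m<n
  ∣i∣<n⇒i<n { -[1+ _ ]} _   = -<+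

  +n<i⇒n<∣i∣ : ∀ {i n} → + n < i → n ℕ.< ∣ i ∣
  +n<i⇒n<∣i∣ (+<+ n<m) = n<m

  0≤i≤+n⇒∣i∣≤n : ∀ {i n} → + 0 ≤ i → i ≤ + n → ∣ i ∣ ℕ.≤ n
  0≤i≤+n⇒∣i∣≤n (+≤+ _) (+≤+ m≤n) = m≤n

  -n<i<n⇒∣i∣<n : ∀ {i n} → - + n < i → i < + n → ∣ i ∣ ℕ.< n
  -n<i<n⇒∣i∣<n {+ _}      {_}     _         (+<+ m<n) = m<n
  -n<i<n⇒∣i∣<n { -[1+ _ ]} {suc _} (-<- m<n) _         = s≤s m<n

module Halving where
  open import Data.Nat using (ℕ; suc)
  open import Data.Integer using (ℤ; +_; _+_; _*_; _≤_)

  -- Abstracts β (i + 1) = (β i - α i d) / 2 with α i ∈ {0, 1}.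
  record IsHalving (d : ℕ) (b : ℕ → ℤ) : Set where
    field
      lower : ∀ i → + 2 * b (suc i) ≤ b i
      upper : ∀ i → b i ≤ + 2 * b (suc i) + + d

open import Data.Nat using (ℕ)
open import Data.Integer using (ℤ)
open Halving using (IsHalving)

module HalvingSequence {d : ℕ} {b : ℕ → ℤ} (halving : IsHalving d b) where
  open import Data.Nat as ℕ using (zero; suc; _≤′_; ≤′-refl; ≤′-step)
  import Data.Nat.Properties as ℕ
  open import Data.Integer hiding (suc)
  open import Data.Integer.Properties
  open import Data.Integer.Tactic.RingSolver using (solve-∀)
  open import Data.Product using (_×_; _,_)
  open import Relation.Binary.PropositionalEquality
  open IntegerOrder
  open IsHalving halving
  open ≤-Reasoning

  -d<b[i]<2d⇒∣b[1+i]∣<d : ∀ i → - + d < b i → b i < + 2 * + d → ∣ b (suc i) ∣ ℕ.< d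
  -d<b[i]<2d⇒∣b[1+i]∣<d i -d<b b<2d = -n<i<n⇒∣i∣<n
    (*-cancelˡ-<-nonNeg (+ 2) (+-cancelʳ-< (+ d) (begin-strict
      + 2 * - + d + + d   ≡⟨ double-neg (+ d) ⟩
      - + d               <⟨ -d<b ⟩
      b i                 ≤⟨ upper i ⟩
      + 2 * b (suc i) + + d ∎)))
    (*-cancelˡ-<-nonNeg (+ 2) (≤-<-trans (lower i) b<2d))
    where
    double-neg : ∀ D → + 2 * - D + D ≡ - D
    double-neg = solve-∀

  ∣b[i]∣<d⇒∣b[1+i]∣<d : ∀ i → ∣ b i ∣ ℕ.< d → ∣ b (suc i) ∣ ℕ.< d
  ∣b[i]∣<d⇒∣b[1+i]∣<d i ∣b∣<d = -d<b[i]<2d⇒∣b[1+i]∣<d i (∣i∣<n⇒-n<i ∣b∣<d)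
    (<-≤-trans (∣i∣<n⇒i<n ∣b∣<d) (subst (+ d ≤_) (pos-* 2 d) (+≤+ (ℕ.m≤n*m d 2))))

  window-stable : ∀ {j i} → j ≤′ i → ∣ b j ∣ ℕ.< d → ∣ b i ∣ ℕ.< d
  window-stable ≤′-refl         ∣b∣<d = ∣b∣<d
  window-stable (≤′-step {i} j≤i) ∣b∣<d = ∣b[i]∣<d⇒∣b[1+i]∣<d i (window-stable j≤i ∣b∣<d)

  private
    scale-step : ∀ n y → + (2 ℕ.* n) * y ≡ + n * (+ 2 * y)
    scale-step n y = trans (cong (_* y) (pos-* 2 n)) (reassoc (+ n) y)
      where
      reassoc : ∀ n y → + 2 * n * y ≡ n * (+ 2 * y)
      reassoc = solve-∀

    pos-*-double : ∀ n → + (n ℕ.* (2 ℕ.* d)) ≡ + n * (+ 2 * + d)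
    pos-*-double n = trans (pos-* n (2 ℕ.* d)) (cong (+ n *_) (pos-* 2 d))

  2^i*b[i]≤b[0] : ∀ i → + (2 ℕ.^ i) * b i ≤ b 0
  2^i*b[i]≤b[0] zero    = ≤-reflexive (*-identityˡ (b 0))
  2^i*b[i]≤b[0] (suc i) = begin
    + (2 ℕ.* 2 ℕ.^ i) * b (suc i) ≡⟨ scale-step (2 ℕ.^ i) (b (suc i)) ⟩
    + (2 ℕ.^ i) * (+ 2 * b (suc i)) ≤⟨ *-monoˡ-≤-nonNeg (+ (2 ℕ.^ i)) (lower i) ⟩
    + (2 ℕ.^ i) * b i             ≤⟨ 2^i*b[i]≤b[0] i ⟩
    b 0                           ∎

  b[0]+d≤2^i*[b[i]+d] : ∀ i → b 0 + + d ≤ + (2 ℕ.^ i) * (b i + + d)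
  b[0]+d≤2^i*[b[i]+d] zero    = ≤-reflexive (sym (*-identityˡ (b 0 + + d)))
  b[0]+d≤2^i*[b[i]+d] (suc i) = begin
    b 0 + + d                                   ≤⟨ b[0]+d≤2^i*[b[i]+d] i ⟩
    + (2 ℕ.^ i) * (b i + + d)                   ≤⟨ *-monoˡ-≤-nonNeg (+ (2 ℕ.^ i)) (+-monoˡ-≤ (+ d) (upper i)) ⟩
    + (2 ℕ.^ i) * (+ 2 * b (suc i) + + d + + d) ≡⟨ cong (+ (2 ℕ.^ i) *_) (regroup (b (suc i)) (+ d)) ⟩
    + (2 ℕ.^ i) * (+ 2 * (b (suc i) + + d))     ≡⟨ scale-step (2 ℕ.^ i) (b (suc i) + + d) ⟨
    + (2 ℕ.* 2 ℕ.^ i) * (b (suc i) + + d)       ∎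
    where
    regroup : ∀ y D → + 2 * y + D + D ≡ + 2 * (y + D)
    regroup = solve-∀

  0≤b[i]⇒b[i]≤b[0] : ∀ i → + 0 ≤ b i → b i ≤ b 0
  0≤b[i]⇒b[i]≤b[0] i 0≤b = begin
    b i                  ≡⟨ *-identityˡ (b i) ⟨
    + 1 * b i            ≤⟨ *-monoʳ-≤-nonNeg (b i) {{nonNegative 0≤b}} (+≤+ (ℕ.m^n>0 2 i)) ⟩
    + (2 ℕ.^ i) * b i    ≤⟨ 2^i*b[i]≤b[0] i ⟩
    b 0                  ∎

  2^i*2d≤b[0]⇒d<b[i] : ∀ i → 1 ℕ.≤ d → + (2 ℕ.^ i ℕ.* (2 ℕ.* d)) ≤ b 0 → + d < b i
  2^i*2d≤b[0]⇒d<b[i] i 1≤d large = +-cancelʳ-< (+ d) (*-cancelˡ-<-nonNeg (+ (2 ℕ.^ i)) (begin-strict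
    + (2 ℕ.^ i) * (+ d + + d)       ≡⟨ cong (+ (2 ℕ.^ i) *_) (twice (+ d)) ⟩
    + (2 ℕ.^ i) * (+ 2 * + d)       ≡⟨ pos-*-double (2 ℕ.^ i) ⟨
    + (2 ℕ.^ i ℕ.* (2 ℕ.* d))       ≤⟨ large ⟩
    b 0                             ≡⟨ +-identityʳ (b 0) ⟨
    b 0 + + 0                       <⟨ +-monoʳ-< (b 0) (+<+ 1≤d) ⟩
    b 0 + + d                       ≤⟨ b[0]+d≤2^i*[b[i]+d] i ⟩
    + (2 ℕ.^ i) * (b i + + d)       ∎))
    where
    twice : ∀ D → D + D ≡ + 2 * D
    twice = solve-∀

  d<b[i]⇒0<b[1+i] : ∀ i → + d < b i → + 0 < b (suc i)
  d<b[i]⇒0<b[1+i] i d<b = *-cancelˡ-<-nonNeg (+ 2) (+-cancelʳ-< (+ d) (begin-strict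
    + 0 + + d             ≡⟨ +-identityˡ (+ d) ⟩
    + d                   <⟨ d<b ⟩
    b i                   ≤⟨ upper i ⟩
    + 2 * b (suc i) + + d ∎))

  b[0]<2^i*2d⇒b[i]<2d : ∀ i → b 0 < + (2 ℕ.^ i ℕ.* (2 ℕ.* d)) → b i < + 2 * + d
  b[0]<2^i*2d⇒b[i]<2d i small = *-cancelˡ-<-nonNeg (+ (2 ℕ.^ i)) (begin-strict
    + (2 ℕ.^ i) * b i                ≤⟨ 2^i*b[i]≤b[0] i ⟩
    b 0                              <⟨ small ⟩
    + (2 ℕ.^ i ℕ.* (2 ℕ.* d))        ≡⟨ pos-*-double (2 ℕ.^ i) ⟩
    + (2 ℕ.^ i) * (+ 2 * + d)        ∎)

  module _ {c : ℕ} (start : b 0 ≡ + c) where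

    window-from-start : c ℕ.< d → ∀ i → ∣ b i ∣ ℕ.< d
    window-from-start c<d i = window-stable (ℕ.≤⇒≤′ ℕ.z≤n) (subst (λ x → ∣ x ∣ ℕ.< d) (sym start) c<d)

    window-after-first : 1 ℕ.≤ d → c ℕ.< 2 ℕ.* d → ∀ i → 1 ℕ.≤ i → ∣ b i ∣ ℕ.< d
    window-after-first (ℕ.s≤s ℕ.z≤n) c<2d i 1≤i = window-stable (ℕ.≤⇒≤′ 1≤i) (-d<b[i]<2d⇒∣b[1+i]∣<d 0
      (subst (- + d <_) (sym start) -<+)
      (subst₂ _<_ (sym start) (pos-* 2 d) (+<+ c<2d)))

    module _ (1≤d : 1 ℕ.≤ d) (m : ℕ) (large : 2 ℕ.^ m ℕ.* (2 ℕ.* d) ℕ.≤ c) where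

      above-d-up-to : ∀ i → i ℕ.≤ m → + d < b i
      above-d-up-to i i≤m = 2^i*2d≤b[0]⇒d<b[i] i 1≤d (subst (_ ≤_) (sym start) (+≤+
        (ℕ.≤-trans (ℕ.*-monoˡ-≤ (2 ℕ.* d) (ℕ.^-monoʳ-≤ 2 i≤m)) large)))

      between-d-and-c : ∀ i → i ℕ.< m ℕ.+ 1 → d ℕ.≤ ∣ b i ∣ × ∣ b i ∣ ℕ.≤ c
      between-d-and-c i i<m+1 =
        ℕ.<⇒≤ (+n<i⇒n<∣i∣ d<b) , 0≤i≤+n⇒∣i∣≤n 0≤b (subst (b i ≤_) start (0≤b[i]⇒b[i]≤b[0] i 0≤b))
        where
        d<b : + d < b i
        d<b = above-d-up-to i (ℕ.m<1+n⇒m≤n (subst (i ℕ.<_) (ℕ.+-comm m 1) i<m+1))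
        0≤b : + 0 ≤ b i
        0≤b = <⇒≤ (≤-<-trans (+≤+ ℕ.z≤n) d<b)

      module _ (small : c ℕ.< 2 ℕ.^ (m ℕ.+ 1) ℕ.* (2 ℕ.* d)) where

        crossing-positive : + 0 < b (m ℕ.+ 1)
        crossing-positive = subst (λ k → + 0 < b k) (ℕ.+-comm 1 m)
          (d<b[i]⇒0<b[1+i] m (above-d-up-to m ℕ.≤-refl))

        crossing-below-twice : b (m ℕ.+ 1) < + 2 * + d
        crossing-below-twice = b[0]<2^i*2d⇒b[i]<2d (m ℕ.+ 1) (subst (_< _) (sym start) (+<+ small))

        below-c-at-crossing : 2 ℕ.* d ℕ.< c → ∣ b (m ℕ.+ 1) ∣ ℕ.< c
        below-c-at-crossing 2d<c = ℕ.<-trans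
          (-n<i<n⇒∣i∣<n (≤-<-trans neg-≤-pos crossing-positive)
                        (subst (b (m ℕ.+ 1) <_) (sym (pos-* 2 d)) crossing-below-twice))
          2d<c

        within-d-after-crossing : ∀ i → m ℕ.+ 1 ℕ.< i → ∣ b i ∣ ℕ.≤ d
        within-d-after-crossing i m+1<i = ℕ.<⇒≤ (window-stable (ℕ.≤⇒≤′ m+1<i)
          (-d<b[i]<2d⇒∣b[1+i]∣<d (m ℕ.+ 1) (≤-<-trans neg-≤-pos crossing-positive) crossing-below-twice))

module TwoAdicExpansion where
  open import Data.Nat as ℕ using (zero; suc; s≤s)
  open import Data.Integer hiding (suc)
  open import Data.Integer.Properties
  open import Data.Integer.DivMod using (_/_; _%_; n%d<d)
  open import Data.Integer.Tactic.RingSolver using (solve-∀)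
  open import Data.Product using (_×_; _,_; proj₁; proj₂)
  open import Relation.Binary.PropositionalEquality
  open Parity

  digit-bounds : ∀ {x y d} a → a ℕ.< 2 → y + + a * + d ≡ x → y ≤ x × x ≤ y + + d
  digit-bounds {x} {y} {d} zero _ y+0≡x = ≤-reflexive y≡x , ≤-trans (≤-reflexive (sym y≡x)) (i≤i+j y (+ d))
    where
    y≡x : y ≡ x
    y≡x = trans (sym (+-identityʳ y)) y+0≡x
  digit-bounds {x} {y} {d} (suc zero) _ y+1*d≡x = subst (y ≤_) y+d≡x (i≤i+j y (+ d)) , ≤-reflexive (sym y+d≡x)
    where
    y+d≡x : y + + d ≡ x
    y+d≡x = trans (cong (_+_ y) (sym (*-identityˡ (+ d)))) y+1*d≡x
  digit-bounds (suc (suc _)) (s≤s (s≤s ())) _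

  module _ (c d : ℕ) (d' : ℤ) (inv : (+ d * d') % + 2 ≡ 1) where

    β-recurrence : ∀ i → + 2 * β c d d' (suc i) + + α c d d' i * + d ≡ β c d d' i
    β-recurrence i = begin
      + 2 * ((x - ad) / + 2) + ad ≡⟨ cong (_+ ad) (*-comm (+ 2) ((x - ad) / + 2)) ⟩
      (x - ad) / + 2 * + 2 + ad   ≡⟨ cong (_+ ad) (2∣x⇒[x/2]*2≡x (inverse-digit-defect-even (+ d) d' inv x)) ⟩
      x - ad + ad                 ≡⟨ sub-add x ad ⟩
      x                           ∎
      where
      open ≡-Reasoning
      x = β c d d' i
      ad = + α c d d' i * + d
      sub-add : ∀ x y → x - y + y ≡ x
      sub-add = solve-∀

    β-isHalving : IsHalving d (β c d d')
    β-isHalving = record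
      { lower = λ i → proj₁ (bounds i)
      ; upper = λ i → proj₂ (bounds i)
      }
      where
      bounds : ∀ i → + 2 * β c d d' (suc i) ≤ β c d d' i × β c d d' i ≤ + 2 * β c d d' (suc i) + + d
      bounds i = digit-bounds (α c d d' i) (n%d<d (β c d d' i * d') (+ 2)) (β-recurrence i)

open import Data.Nat using (_<_; _≤_; _+_; _*_; _^_)
open import Data.Nat.GCD using (gcd)
open import Data.Integer using (∣_∣; +_) renaming (_*_ to _*ℤ_)
open import Data.Integer.DivMod using (_%_)
open import Data.Product using (_×_; _,_)
open import Relation.Binary.PropositionalEquality using (_≡_; refl)

corollary3p1 : (c d : ℕ) → 1 ≤ d → gcd c 2 ≡ 1 → gcd d 2 ≡ 1 → gcd c d ≡ 1 →
    (d' : ℤ) → ((+ d) *ℤ d') % (+ 2) ≡ 1 →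
    ((c < d → (i : ℕ) → ∣ β c d d' i ∣ < d)
    × (d < c → c < 2 * d → (i : ℕ) → 1 ≤ i → ∣ β c d d' i ∣ < d)
    × (d < c → 2 * d < c → (m : ℕ) → 2 ^ m * (2 * d) ≤ c → c < 2 ^ (m + 1) * (2 * d) →
        ((i : ℕ) → i < m + 1 → (d ≤ ∣ β c d d' i ∣) × (∣ β c d d' i ∣ ≤ c))
        × ((i : ℕ) → m + 1 < i → ∣ β c d d' i ∣ ≤ d)
        × (∣ β c d d' (m + 1) ∣ < c)))
corollary3p1 c d 1≤d _ _ _ d' inv =
    window-from-start refl
  , (λ _ → window-after-first refl 1≤d)
  , λ _ 2d<c m large small →
        between-d-and-c refl 1≤d m large
      , within-d-after-crossing refl 1≤d m large small
      , below-c-at-crossing refl 1≤d m large small 2d<c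
  where open HalvingSequence (TwoAdicExpansion.β-isHalving c d d' inv)
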